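{- There is an absolute constant $C$ such that for every $n$ and every vertex $v$ of $\texttt{GRID}_n$ adjacent to the sink, the potential profile satisfies $$\Gamma(v)=\sum_{u\in V_o}(d(u)-1)\,\pi_v(u)=3\sum_{u\in V_o}\pi_v(u)\le C\,n.$$
   Context: $\texttt{GRID}_n$ is the $n\times n$ grid graph on vertices $(i,j)$, $1\le i,j\le n$, with an added sink vertex $s$ joined by one edge to each non-corner boundary vertex and by two edges to each corner vertex; $V_o$ is the set of grid vertices, each of degree $d(u)=4$. For $v\in V_o$, $\pi_v$ is the function with $\pi_v(s)=0$, $\pi_v(v)=1$, harmonic (average over incident edges with multiplicity) at all other vertices; i.e. the potentials in the unit-resistor network with $v$ at potential 1 and the sink grounded. -}

module Defs where

open import Data.Nat as ℕ using (ℕ; zero; suc; _<?_)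
open import Data.Fin using (Fin; toℕ; fromℕ<)
open import Data.Integer using (+_)
open import Data.Rational using (ℚ; 0ℚ; 1ℚ; _+_; _*_; _-_; _/_)
open import Data.List using (List; map; foldr; allFin)
open import Data.Product using (_×_; _,_)
open import Data.Sum using (_⊎_)
open import Relation.Nullary using (yes; no; ¬_)
open import Relation.Binary.PropositionalEquality using (_≡_)

ℕ→ℚ : ℕ → ℚ
ℕ→ℚ k = + k / 1

-- A function on the grid vertices of GRID_n; vertex (i,j) with 0-based
-- coordinates i j : Fin n (the paper's (i+1, j+1)).
Pot : ℕ → Set
Pot n = Fin n → Fin n → ℚ

-- Extension of a grid function by the sink value 0: any position outside the
-- n×n grid stands for the sink s, where the potential is 0.
ext : ∀ {n} → Pot n → ℕ → ℕ → ℚ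
ext {n} π a b with a <? n | b <? n
... | yes p | yes q = π (fromℕ< p) (fromℕ< q)
... | _     | _     = 0ℚ

-- value at coordinate (k - 1), where coordinate -1 is outside the grid (sink)
below : (ℕ → ℚ) → ℕ → ℚ
below f zero    = 0ℚ
below f (suc k) = f k

-- Sum of π over the 4 edges incident to grid vertex (i,j), counted with
-- multiplicity; each edge to the sink contributes π(s) = 0.
-- (Corners have two sink edges, non-corner boundary vertices one.)
nbrSum : ∀ {n} → Pot n → Fin n → Fin n → ℚ
nbrSum π i j =
  ext π (suc (toℕ i)) (toℕ j) + below (λ a → ext π a (toℕ j)) (toℕ i)
  + ext π (toℕ i) (suc (toℕ j)) + below (λ b → ext π (toℕ i) b) (toℕ j)

deg : ℚ
deg = ℕ→ℚ 4

-- π is the potential π_v for v = (vi,vj): π_v(v) = 1, π_v(s) = 0 (built into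
-- ext), and harmonic at every other grid vertex u: d(u) π(u) = Σ_{edges} π.
IsPotential : ∀ {n} → Fin n → Fin n → Pot n → Set
IsPotential {n} vi vj π =
  (π vi vj ≡ 1ℚ) ×
  (∀ (i j : Fin n) → ¬ ((i , j) ≡ (vi , vj)) → deg * π i j ≡ nbrSum π i j)

AdjSink : (n : ℕ) → Fin n → Fin n → Set
AdjSink n vi vj =
  (toℕ vi ≡ 0) ⊎ (suc (toℕ vi) ≡ n) ⊎ (toℕ vj ≡ 0) ⊎ (suc (toℕ vj) ≡ n)

sumFin : ∀ n → (Fin n → ℚ) → ℚ
sumFin n f = foldr _+_ 0ℚ (map f (allFin n))

sumV : ∀ {n} → Pot n → ℚ
sumV {n} f = sumFin n (λ i → sumFin n (λ j → f i j))

Gamma : ∀ {n} → Pot n → ℚ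
Gamma π = sumV (λ i j → (deg - 1ℚ) * π i j)

-- Extend π_v by 0 off the grid and write Δ F = deg·F − (sum of the four neighbours).
-- By the minimum principle π_v ≥ 0.  The parabola G(a,b) = 2(1+a)(n−a) in the row index
-- has ΔG ≥ deg on the grid and vanishes just outside it, so summation by parts gives
--   deg · Σ π_v ≤ Σ π_v ΔG = Σ G Δπ_v = G(v) Δπ_v(v) ≤ deg · G(v),
-- because Δπ_v vanishes off v and Δπ_v(v) ≤ deg·π_v(v) = deg.  For v in the first or last
-- row G(v) = 2n, hence Σ π_v ≤ 2n and Γ(v) = 3 Σ π_v ≤ 6n; for v in the first or last
-- column use the transposed parabola.
module Submission where

open import Defs
open import Data.Nat using (ℕ)
open import Data.Fin using (Fin)
open import Data.Rational using (_*_; _≤_)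
open import Data.Product using (∃-syntax; _×_)
open import Relation.Binary.PropositionalEquality using (_≡_)

open import Data.Nat as ℕ using (zero; suc; _<_; _≤′_; ≤′-refl; ≤′-step)
import Data.Nat.Properties as ℕ
open import Data.Fin as Fin using (toℕ; fromℕ<)
open import Data.Fin.Properties using (toℕ<n; toℕ-fromℕ<; fromℕ<-toℕ)
import Data.Integer as ℤ
import Data.Integer.Properties as ℤ
open import Data.Rational as ℚ using (ℚ; 0ℚ; 1ℚ; _+_; _-_; -_; toℚᵘ; nonNegative)
open import Data.Rational.Properties
import Data.Rational.Unnormalised as ℚᵘ
import Data.Rational.Unnormalised.Properties as ℚᵘ
open import Data.Rational.Solver using (module +-*-Solver)
open +-*-Solver using (solve; _:+_; _:*_; _:-_; con; _:=_; Polynomial)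
open import Data.Product as Product using (_,_; proj₁; proj₂; uncurry)
open import Data.Sum as Sum using (_⊎_; inj₁; inj₂)
open import Data.Empty using (⊥-elim)
open import Data.List using (List; cartesianProduct; upTo; foldr; map; tabulate)
open import Data.List.Properties using (map-tabulate)
import Data.List.Relation.Unary.All as All
open import Data.List.Membership.Propositional.Properties
  using (∈-upTo⁺; ∈-upTo⁻; ∈-cartesianProduct⁺; ∈-cartesianProduct⁻)
open import Relation.Binary.Bundles using (DecTotalOrder)
open import Data.List.Extrema (DecTotalOrder.totalOrder ≤-decTotalOrder)
  using (argmin; argmin-sel; f[argmin]≤f[xs])
open import Function using (_∘_; id; flip)
open import Relation.Nullary using (yes; no)
open import Relation.Binary.PropositionalEquality
  using (refl; sym; trans; cong; cong₂; subst; subst₂; _≢_; module ≡-Reasoning)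

ℕ→ℚ-suc : ∀ k → ℕ→ℚ (suc k) ≡ 1ℚ + ℕ→ℚ k
ℕ→ℚ-suc k = toℚᵘ-injective (begin
  toℚᵘ (ℕ→ℚ (suc k))               ≈⟨ toℚᵘ-fromℚᵘ (ℚᵘ.mkℚᵘ (ℤ.+ suc k) 0) ⟩
  ℚᵘ.mkℚᵘ (ℤ.+ suc k) 0             ≈⟨ ℚᵘ.*≡* numerators ⟩
  toℚᵘ 1ℚ ℚᵘ.+ ℚᵘ.mkℚᵘ (ℤ.+ k) 0    ≈⟨ ℚᵘ.+-congʳ (toℚᵘ 1ℚ) (toℚᵘ-fromℚᵘ (ℚᵘ.mkℚᵘ (ℤ.+ k) 0)) ⟨
  toℚᵘ 1ℚ ℚᵘ.+ toℚᵘ (ℕ→ℚ k)        ≈⟨ toℚᵘ-homo-+ 1ℚ (ℕ→ℚ k) ⟨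
  toℚᵘ (1ℚ + ℕ→ℚ k)                ∎)
  where
  open ℚᵘ.≃-Reasoning
  numerators : ℤ.+ suc k ℤ.* ℤ.+ 1 ≡ (ℤ.+ 1 ℤ.* ℤ.+ 1 ℤ.+ ℤ.+ k ℤ.* ℤ.+ 1) ℤ.* ℤ.+ 1
  numerators = trans (ℤ.*-identityʳ (ℤ.+ suc k))
                     (sym (trans (ℤ.*-identityʳ _) (cong (ℤ._+_ (ℤ.+ 1)) (ℤ.*-identityʳ (ℤ.+ k)))))

ℕ→ℚ-nonNeg : ∀ k → 0ℚ ≤ ℕ→ℚ k
ℕ→ℚ-nonNeg k = nonNegative⁻¹ (ℕ→ℚ k) {{normalize-nonNeg k 1}}

ℕ→ℚ-mono-≤′ : ∀ {j k} → j ≤′ k → ℕ→ℚ j ≤ ℕ→ℚ k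
ℕ→ℚ-mono-≤′ ≤′-refl                = ≤-refl
ℕ→ℚ-mono-≤′ {j} (≤′-step {k} j≤′k) = begin
  ℕ→ℚ j        ≤⟨ ℕ→ℚ-mono-≤′ j≤′k ⟩
  ℕ→ℚ k        ≡⟨ +-identityˡ (ℕ→ℚ k) ⟨
  0ℚ + ℕ→ℚ k   ≤⟨ +-monoˡ-≤ (ℕ→ℚ k) (ℕ→ℚ-nonNeg 1) ⟩
  1ℚ + ℕ→ℚ k   ≡⟨ ℕ→ℚ-suc k ⟨
  ℕ→ℚ (suc k)  ∎
  where open ≤-Reasoning

ℕ→ℚ-mono-≤ : ∀ {j k} → j ℕ.≤ k → ℕ→ℚ j ≤ ℕ→ℚ k
ℕ→ℚ-mono-≤ = ℕ→ℚ-mono-≤′ ∘ ℕ.≤⇒≤′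

*-nonNeg : ∀ {p q} → 0ℚ ≤ p → 0ℚ ≤ q → 0ℚ ≤ p * q
*-nonNeg {p} {q} 0≤p 0≤q = nonNegative⁻¹ (p * q) {{nonNeg*nonNeg⇒nonNeg p {{nonNegative 0≤p}} q {{nonNegative 0≤q}}}}

∑ : ℕ → (ℕ → ℚ) → ℚ
∑ zero    f = 0ℚ
∑ (suc n) f = f 0 + ∑ n (f ∘ suc)

∑-cong : ∀ n {f g : ℕ → ℚ} → (∀ a → a < n → f a ≡ g a) → ∑ n f ≡ ∑ n g
∑-cong zero    f≡g = refl
∑-cong (suc n) f≡g = cong₂ _+_ (f≡g 0 ℕ.z<s) (∑-cong n (λ a a<n → f≡g (suc a) (ℕ.s<s a<n)))

∑-mono-≤ : ∀ n {f g : ℕ → ℚ} → (∀ a → a < n → f a ≤ g a) → ∑ n f ≤ ∑ n g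
∑-mono-≤ zero    f≤g = ≤-refl
∑-mono-≤ (suc n) f≤g = +-mono-≤ (f≤g 0 ℕ.z<s) (∑-mono-≤ n (λ a a<n → f≤g (suc a) (ℕ.s<s a<n)))

∑-zero : ∀ n {f : ℕ → ℚ} → (∀ a → a < n → f a ≡ 0ℚ) → ∑ n f ≡ 0ℚ
∑-zero zero    f≡0 = refl
∑-zero (suc n) f≡0 = trans (cong₂ _+_ (f≡0 0 ℕ.z<s) (∑-zero n (λ a a<n → f≡0 (suc a) (ℕ.s<s a<n))))
                           (+-identityʳ 0ℚ)

∑-distrib-+ : ∀ n (f g : ℕ → ℚ) → ∑ n (λ a → f a + g a) ≡ ∑ n f + ∑ n g
∑-distrib-+ zero    f g = sym (+-identityʳ 0ℚ)
∑-distrib-+ (suc n) f g = trans (cong (f 0 + g 0 +_) (∑-distrib-+ n (f ∘ suc) (g ∘ suc)))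
  (solve 4 (λ x y z w → (x :+ y) :+ (z :+ w) := (x :+ z) :+ (y :+ w)) refl
         (f 0) (g 0) (∑ n (f ∘ suc)) (∑ n (g ∘ suc)))

∑-distrib-- : ∀ n (f g : ℕ → ℚ) → ∑ n (λ a → f a - g a) ≡ ∑ n f - ∑ n g
∑-distrib-- zero    f g = refl
∑-distrib-- (suc n) f g = trans (cong (f 0 - g 0 +_) (∑-distrib-- n (f ∘ suc) (g ∘ suc)))
  (solve 4 (λ x y z w → (x :- y) :+ (z :- w) := (x :+ z) :- (y :+ w)) refl
         (f 0) (g 0) (∑ n (f ∘ suc)) (∑ n (g ∘ suc)))

*-distribˡ-∑ : ∀ n c (f : ℕ → ℚ) → c * ∑ n f ≡ ∑ n (λ a → c * f a)
*-distribˡ-∑ zero    c f = *-zeroʳ c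
*-distribˡ-∑ (suc n) c f = trans (*-distribˡ-+ c (f 0) (∑ n (f ∘ suc)))
                                 (cong (c * f 0 +_) (*-distribˡ-∑ n c (f ∘ suc)))

∑-init-last : ∀ n (f : ℕ → ℚ) → ∑ (suc n) f ≡ ∑ n f + f n
∑-init-last zero    f = trans (+-identityʳ (f 0)) (sym (+-identityˡ (f 0)))
∑-init-last (suc n) f = trans (cong (f 0 +_) (∑-init-last n (f ∘ suc))) (sym (+-assoc (f 0) _ _))

∑-comm : ∀ m n (f : ℕ → ℕ → ℚ) → ∑ m (λ a → ∑ n (f a)) ≡ ∑ n (λ b → ∑ m (λ a → f a b))
∑-comm zero    n f = sym (∑-zero n (λ _ _ → refl))
∑-comm (suc m) n f = trans (cong (∑ n (f 0) +_) (∑-comm m n (f ∘ suc)))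
                           (sym (∑-distrib-+ n (f 0) (λ b → ∑ m (λ a → f (suc a) b))))

∑-single-support : ∀ n {f : ℕ → ℚ} a₀ → a₀ < n → (∀ a → a < n → a ≢ a₀ → f a ≡ 0ℚ) → ∑ n f ≡ f a₀
∑-single-support (suc n) {f} zero _ f≡0 =
  trans (cong (f 0 +_) (∑-zero n (λ a a<n → f≡0 (suc a) (ℕ.s<s a<n) (λ ())))) (+-identityʳ (f 0))
∑-single-support (suc n) (suc a₀) (ℕ.s<s a₀<n) f≡0 =
  trans (cong₂ _+_ (f≡0 0 ℕ.z<s (λ ()))
                   (∑-single-support n a₀ a₀<n (λ a a<n a≢a₀ → f≡0 (suc a) (ℕ.s<s a<n) (a≢a₀ ∘ ℕ.suc-injective))))
        (+-identityˡ _)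

neighbours : (ℕ → ℚ) → ℕ → ℚ
neighbours f a = f (suc a) + below f a

∑-shift-product : ∀ n (f g : ℕ → ℚ) → f n ≡ 0ℚ →
                  ∑ n (λ b → g b * f (suc b)) ≡ ∑ n (λ b → f b * below g b)
∑-shift-product zero    f g _     = refl
∑-shift-product (suc m) f g f[n]≡0 = begin
  ∑ (suc m) (λ b → g b * f (suc b))  ≡⟨ ∑-init-last m _ ⟩
  S + g m * f (suc m)                ≡⟨ cong (λ x → S + g m * x) f[n]≡0 ⟩
  S + g m * 0ℚ                       ≡⟨ cong (S +_) (*-zeroʳ (g m)) ⟩
  S + 0ℚ                             ≡⟨ +-identityʳ S ⟩
  S                                  ≡⟨ ∑-cong m (λ b _ → *-comm (g b) (f (suc b))) ⟩
  S′                                 ≡⟨ +-identityˡ S′ ⟨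
  0ℚ + S′                            ≡⟨ cong (_+ S′) (*-zeroʳ (f 0)) ⟨
  f 0 * 0ℚ + S′                      ∎
  where
  open ≡-Reasoning
  S S′ : ℚ
  S  = ∑ m (λ b → g b * f (suc b))
  S′ = ∑ m (λ b → f (suc b) * g b)

∑-neighbours-selfAdjoint : ∀ n (f g : ℕ → ℚ) → f n ≡ 0ℚ → g n ≡ 0ℚ →
  ∑ n (λ b → g b * neighbours f b) ≡ ∑ n (λ b → f b * neighbours g b)
∑-neighbours-selfAdjoint n f g f[n]≡0 g[n]≡0 = begin
  ∑ n (λ b → g b * neighbours f b)                         ≡⟨ ∑-cong n (λ b _ → *-distribˡ-+ (g b) _ _) ⟩
  ∑ n (λ b → g b * f (suc b) + g b * below f b)            ≡⟨ ∑-distrib-+ n _ _ ⟩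
  ∑ n (λ b → g b * f (suc b)) + ∑ n (λ b → g b * below f b)
    ≡⟨ cong₂ _+_ (∑-shift-product n f g f[n]≡0) (sym (∑-shift-product n g f g[n]≡0)) ⟩
  ∑ n (λ b → f b * below g b) + ∑ n (λ b → f b * g (suc b)) ≡⟨ +-comm (∑ n _) (∑ n _) ⟩
  ∑ n (λ b → f b * g (suc b)) + ∑ n (λ b → f b * below g b) ≡⟨ ∑-distrib-+ n _ _ ⟨
  ∑ n (λ b → f b * g (suc b) + f b * below g b)            ≡⟨ ∑-cong n (λ b _ → *-distribˡ-+ (f b) _ _) ⟨
  ∑ n (λ b → f b * neighbours g b)                         ∎
  where open ≡-Reasoning

∑² : ℕ → (ℕ → ℕ → ℚ) → ℚ
∑² n F = ∑ n (λ a → ∑ n (F a))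

module _ (n : ℕ) where

  ∑²-cong : {F G : ℕ → ℕ → ℚ} → (∀ a b → a < n → b < n → F a b ≡ G a b) → ∑² n F ≡ ∑² n G
  ∑²-cong F≡G = ∑-cong n (λ a a<n → ∑-cong n (λ b b<n → F≡G a b a<n b<n))

  ∑²-mono-≤ : {F G : ℕ → ℕ → ℚ} → (∀ a b → a < n → b < n → F a b ≤ G a b) → ∑² n F ≤ ∑² n G
  ∑²-mono-≤ F≤G = ∑-mono-≤ n (λ a a<n → ∑-mono-≤ n (λ b b<n → F≤G a b a<n b<n))

  ∑²-distrib-+ : (F G : ℕ → ℕ → ℚ) → ∑² n (λ a b → F a b + G a b) ≡ ∑² n F + ∑² n G
  ∑²-distrib-+ F G = trans (∑-cong n (λ a _ → ∑-distrib-+ n (F a) (G a))) (∑-distrib-+ n _ _)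

  ∑²-distrib-- : (F G : ℕ → ℕ → ℚ) → ∑² n (λ a b → F a b - G a b) ≡ ∑² n F - ∑² n G
  ∑²-distrib-- F G = trans (∑-cong n (λ a _ → ∑-distrib-- n (F a) (G a))) (∑-distrib-- n _ _)

  *-distribˡ-∑² : ∀ c (F : ℕ → ℕ → ℚ) → c * ∑² n F ≡ ∑² n (λ a b → c * F a b)
  *-distribˡ-∑² c F = trans (*-distribˡ-∑ n c _) (∑-cong n (λ a _ → *-distribˡ-∑ n c (F a)))

  ∑²-flip : (F : ℕ → ℕ → ℚ) → ∑² n (flip F) ≡ ∑² n F
  ∑²-flip F = ∑-comm n n (flip F)

  ∑²-single-support : ∀ {F : ℕ → ℕ → ℚ} a₀ b₀ → a₀ < n → b₀ < n →
    (∀ a b → a < n → b < n → (a , b) ≢ (a₀ , b₀) → F a b ≡ 0ℚ) → ∑² n F ≡ F a₀ b₀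
  ∑²-single-support a₀ b₀ a₀<n b₀<n F≡0 =
    trans (∑-single-support n a₀ a₀<n
             (λ a a<n a≢a₀ → ∑-zero n (λ b b<n → F≡0 a b a<n b<n (a≢a₀ ∘ cong proj₁))))
          (∑-single-support n b₀ b₀<n (λ b b<n b≢b₀ → F≡0 a₀ b a₀<n b<n (b≢b₀ ∘ cong proj₂)))

neighbourSum : (ℕ → ℕ → ℚ) → ℕ → ℕ → ℚ
neighbourSum F a b = neighbours (λ x → F x b) a + neighbours (F a) b

neighbourSum-flip : ∀ (F : ℕ → ℕ → ℚ) a b → neighbourSum (flip F) a b ≡ neighbourSum F b a
neighbourSum-flip F a b = +-comm (neighbours (F b) a) (neighbours (λ x → F x a) b)

Δ : (ℕ → ℕ → ℚ) → ℕ → ℕ → ℚ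
Δ F a b = deg * F a b - neighbourSum F a b

Supported : ℕ → (ℕ → ℕ → ℚ) → Set
Supported n F = ∀ a b → n ℕ.≤ a ⊎ n ℕ.≤ b → F a b ≡ 0ℚ

module _ {n : ℕ} {F G : ℕ → ℕ → ℚ} (F-supp : Supported n F) (G-supp : Supported n G) where

  ∑²-neighbourSum-selfAdjoint :
    ∑² n (λ a b → G a b * neighbourSum F a b) ≡ ∑² n (λ a b → F a b * neighbourSum G a b)
  ∑²-neighbourSum-selfAdjoint = begin
    ∑² n (λ a b → G a b * neighbourSum F a b)       ≡⟨ split F G ⟩
    rows (flip F) (flip G) + rows F G
      ≡⟨ cong₂ _+_ (rows-selfAdjoint (flip F) (flip G) (last-row F-supp) (last-row G-supp))
                   (rows-selfAdjoint F G (last-column F-supp) (last-column G-supp)) ⟩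
    rows (flip G) (flip F) + rows G F               ≡⟨ split G F ⟨
    ∑² n (λ a b → F a b * neighbourSum G a b)       ∎
    where
    open ≡-Reasoning
    last-row : ∀ {H} → Supported n H → ∀ b → H n b ≡ 0ℚ
    last-row H-supp b = H-supp n b (inj₁ ℕ.≤-refl)

    last-column : ∀ {H} → Supported n H → ∀ a → H a n ≡ 0ℚ
    last-column H-supp a = H-supp a n (inj₂ ℕ.≤-refl)

    rows : (ℕ → ℕ → ℚ) → (ℕ → ℕ → ℚ) → ℚ
    rows F G = ∑² n (λ a b → G a b * neighbours (F a) b)

    rows-selfAdjoint : ∀ F G → (∀ a → F a n ≡ 0ℚ) → (∀ a → G a n ≡ 0ℚ) → rows F G ≡ rows G F
    rows-selfAdjoint F G F[n]≡0 G[n]≡0 =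
      ∑-cong n (λ a _ → ∑-neighbours-selfAdjoint n (F a) (G a) (F[n]≡0 a) (G[n]≡0 a))

    split : ∀ F G → ∑² n (λ a b → G a b * neighbourSum F a b) ≡ rows (flip F) (flip G) + rows F G
    split F G = trans (∑²-cong n (λ a b _ _ → *-distribˡ-+ (G a b) _ _))
                      (trans (∑²-distrib-+ n _ _) (cong (_+ rows F G) (sym (∑²-flip n _))))

  ∑²-Δ-selfAdjoint : ∑² n (λ a b → F a b * Δ G a b) ≡ ∑² n (λ a b → G a b * Δ F a b)
  ∑²-Δ-selfAdjoint = begin
    ∑² n (λ a b → F a b * Δ G a b)                                       ≡⟨ expand F G ⟩
    deg * ∑² n (λ a b → F a b * G a b) - ∑² n (λ a b → F a b * neighbourSum G a b)
      ≡⟨ cong₂ (λ x y → deg * x - y) (∑²-cong n (λ a b _ _ → *-comm (F a b) (G a b)))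
                                     (sym ∑²-neighbourSum-selfAdjoint) ⟩
    deg * ∑² n (λ a b → G a b * F a b) - ∑² n (λ a b → G a b * neighbourSum F a b) ≡⟨ expand G F ⟨
    ∑² n (λ a b → G a b * Δ F a b)                                       ∎
    where
    open ≡-Reasoning
    expand : ∀ F G → ∑² n (λ a b → F a b * Δ G a b) ≡
             deg * ∑² n (λ a b → F a b * G a b) - ∑² n (λ a b → F a b * neighbourSum G a b)
    expand F G = begin
      ∑² n (λ a b → F a b * Δ G a b)
        ≡⟨ ∑²-cong n (λ a b _ _ → solve 4 (λ d f g s → f :* (d :* g :- s) := d :* (f :* g) :- f :* s) refl
                                        deg (F a b) (G a b) (neighbourSum G a b)) ⟩
      ∑² n (λ a b → deg * (F a b * G a b) - F a b * neighbourSum G a b)      ≡⟨ ∑²-distrib-- n _ _ ⟩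
      ∑² n (λ a b → deg * (F a b * G a b)) - ∑² n (λ a b → F a b * neighbourSum G a b)
        ≡⟨ cong (_- ∑² n (λ a b → F a b * neighbourSum G a b)) (*-distribˡ-∑² n deg _) ⟨
      deg * ∑² n (λ a b → F a b * G a b) - ∑² n (λ a b → F a b * neighbourSum G a b) ∎

neighbours-nonNeg : ∀ {f : ℕ → ℚ} → (∀ x → 0ℚ ≤ f x) → ∀ a → 0ℚ ≤ neighbours f a
neighbours-nonNeg 0≤f zero    = +-mono-≤ (0≤f 1) ≤-refl
neighbours-nonNeg 0≤f (suc a) = +-mono-≤ (0≤f (suc (suc a))) (0≤f a)

neighbourSum-nonNeg : ∀ {F : ℕ → ℕ → ℚ} → (∀ a b → 0ℚ ≤ F a b) → ∀ a b → 0ℚ ≤ neighbourSum F a b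
neighbourSum-nonNeg 0≤F a b = +-mono-≤ (neighbours-nonNeg (λ x → 0≤F x b) a) (neighbours-nonNeg (0≤F a) b)

∃-minimiser : ∀ {n a b} (F : ℕ → ℕ → ℚ) → a < n → b < n →
  ∃[ a* ] ∃[ b* ] (a* < n × b* < n × (∀ x y → x < n → y < n → F a* b* ≤ F x y))
∃-minimiser {n} {a} {b} F a<n b<n = proj₁ m , proj₂ m , proj₁ m∈box , proj₂ m∈box , minimal
  where
  box : List (ℕ × ℕ)
  box = cartesianProduct (upTo n) (upTo n)

  m : ℕ × ℕ
  m = argmin (uncurry F) (a , b) box

  m∈box : proj₁ m < n × proj₂ m < n
  m∈box with argmin-sel (uncurry F) (a , b) box
  ... | inj₁ m≡ab = subst (λ p → proj₁ p < n × proj₂ p < n) (sym m≡ab) (a<n , b<n)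
  ... | inj₂ m∈   = Product.map ∈-upTo⁻ ∈-upTo⁻ (∈-cartesianProduct⁻ (upTo n) (upTo n) m∈)

  minimal : ∀ x y → x < n → y < n → uncurry F m ≤ F x y
  minimal x y x<n y<n =
    All.lookup (f[argmin]≤f[xs] (a , b) box) (∈-cartesianProduct⁺ (∈-upTo⁺ x<n) (∈-upTo⁺ y<n))

record GridPotential (n va vb : ℕ) (F : ℕ → ℕ → ℚ) : Set where
  field
    va<n      : va < n
    vb<n      : vb < n
    supported : Supported n F
    at-source : F va vb ≡ 1ℚ
    harmonic  : ∀ a b → a < n → b < n → (a , b) ≢ (va , vb) → deg * F a b ≡ neighbourSum F a b

record Supersolution (n : ℕ) (G : ℕ → ℕ → ℚ) : Set where
  field
    supported : Supported n G
    deg≤Δ     : ∀ a b → a < n → b < n → deg ≤ Δ G a b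

module _ {n va vb : ℕ} {F : ℕ → ℕ → ℚ} (P : GridPotential n va vb F) where
  open GridPotential P

  private
    module NegativeMinimum (μ : ℚ) (μ<0 : μ ℚ.< 0ℚ) (μ≤F : ∀ a b → a < n → b < n → μ ≤ F a b) where

      μ≤F-everywhere : ∀ a b → μ ≤ F a b
      μ≤F-everywhere a b with a ℕ.<? n | b ℕ.<? n
      ... | yes a<n | yes b<n = μ≤F a b a<n b<n
      ... | no  a≮n | _       = subst (μ ≤_) (sym (supported a b (inj₁ (ℕ.≮⇒≥ a≮n)))) (<⇒≤ μ<0)
      ... | yes _   | no  b≮n = subst (μ ≤_) (sym (supported a b (inj₂ (ℕ.≮⇒≥ b≮n)))) (<⇒≤ μ<0)

      μ≤below : ∀ (f : ℕ → ℚ) → (∀ x → μ ≤ f x) → ∀ a → μ ≤ below f a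
      μ≤below f μ≤f zero    = <⇒≤ μ<0
      μ≤below f μ≤f (suc a) = μ≤f a

      μ<F[v] : μ ℚ.< F va vb
      μ<F[v] = <-≤-trans μ<0 (subst (0ℚ ≤_) (sym at-source) (nonNegative⁻¹ 1ℚ))

      -- At a minimum point the mean-value property forces every neighbour to be a minimum too.
      below≤μ : ∀ a b → a < n → b < n → F a b ≡ μ → below (λ x → F x b) a ≤ μ
      below≤μ a b a<n b<n F≡μ = ≮⇒≥ λ μ<below → <-irrefl mean (begin-strict
        deg * μ             ≡⟨ solve 1 (λ m → con deg :* m := (m :+ m) :+ (m :+ m)) refl μ ⟩
        (μ + μ) + (μ + μ)
          <⟨ +-mono-<-≤ (+-mono-≤-< (μ≤F-everywhere (suc a) b) μ<below)
                        (+-mono-≤ (μ≤F-everywhere a (suc b)) (μ≤below (F a) (μ≤F-everywhere a) b)) ⟩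
        neighbourSum F a b  ∎)
        where
        open ≤-Reasoning
        ab≢v : (a , b) ≢ (va , vb)
        ab≢v refl = <-irrefl (sym F≡μ) μ<F[v]
        mean : deg * μ ≡ neighbourSum F a b
        mean = trans (cong (deg *_) (sym F≡μ)) (harmonic a b a<n b<n ab≢v)

      unattained : ∀ a b → a < n → b < n → F a b ≢ μ
      unattained zero    b a<n b<n F≡μ = <-irrefl refl (<-≤-trans μ<0 (below≤μ 0 b a<n b<n F≡μ))
      unattained (suc a) b a<n b<n F≡μ = unattained a b (ℕ.<-trans (ℕ.n<1+n a) a<n) b<n
        (≤-antisym (below≤μ (suc a) b a<n b<n F≡μ) (μ≤F-everywhere a b))

    0≤minimum : ∀ {a* b*} → a* < n → b* < n → (∀ x y → x < n → y < n → F a* b* ≤ F x y) → 0ℚ ≤ F a* b*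
    0≤minimum {a*} {b*} a*<n b*<n minimal with 0ℚ ≤? F a* b*
    ... | yes 0≤μ = 0≤μ
    ... | no  0≰μ = ⊥-elim (NegativeMinimum.unattained (F a* b*) (≰⇒> 0≰μ) minimal a* b* a*<n b*<n refl)

  potential-nonNeg : ∀ a b → 0ℚ ≤ F a b
  potential-nonNeg a b with a ℕ.<? n | b ℕ.<? n | ∃-minimiser F va<n vb<n
  ... | yes a<n | yes b<n | _ , _ , a*<n , b*<n , minimal =
    ≤-trans (0≤minimum a*<n b*<n minimal) (minimal a b a<n b<n)
  ... | no  a≮n | _       | _ = ≤-reflexive (sym (supported a b (inj₁ (ℕ.≮⇒≥ a≮n))))
  ... | yes _   | no  b≮n | _ = ≤-reflexive (sym (supported a b (inj₂ (ℕ.≮⇒≥ b≮n))))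

  ∑²≤supersolution : ∀ {G} → Supersolution n G → 0ℚ ≤ G va vb → ∑² n F ≤ G va vb
  ∑²≤supersolution {G} S 0≤G[v] = *-cancelˡ-≤-pos deg (begin
    deg * ∑² n F                    ≡⟨ *-distribˡ-∑² n deg F ⟩
    ∑² n (λ a b → deg * F a b)      ≤⟨ ∑²-mono-≤ n weighted ⟩
    ∑² n (λ a b → F a b * Δ G a b)  ≡⟨ ∑²-Δ-selfAdjoint supported (Supersolution.supported S) ⟩
    ∑² n (λ a b → G a b * Δ F a b)  ≡⟨ ∑²-single-support n va vb va<n vb<n off-source ⟩
    G va vb * Δ F va vb             ≤⟨ *-monoˡ-≤-nonNeg (G va vb) {{nonNegative 0≤G[v]}} Δ-at-source ⟩
    G va vb * deg                   ≡⟨ *-comm (G va vb) deg ⟩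
    deg * G va vb                   ∎)
    where
    open ≤-Reasoning
    weighted : ∀ a b → a < n → b < n → deg * F a b ≤ F a b * Δ G a b
    weighted a b a<n b<n = subst (_≤ F a b * Δ G a b) (*-comm (F a b) deg)
      (*-monoˡ-≤-nonNeg (F a b) {{nonNegative (potential-nonNeg a b)}} (Supersolution.deg≤Δ S a b a<n b<n))

    off-source : ∀ a b → a < n → b < n → (a , b) ≢ (va , vb) → G a b * Δ F a b ≡ 0ℚ
    off-source a b a<n b<n ab≢v = begin-equality
      G a b * (deg * F a b - neighbourSum F a b)
        ≡⟨ cong (λ x → G a b * (x - neighbourSum F a b)) (harmonic a b a<n b<n ab≢v) ⟩
      G a b * (neighbourSum F a b - neighbourSum F a b)    ≡⟨ cong (G a b *_) (+-inverseʳ (neighbourSum F a b)) ⟩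
      G a b * 0ℚ                                           ≡⟨ *-zeroʳ (G a b) ⟩
      0ℚ                                                   ∎

    Δ-at-source : Δ F va vb ≤ deg
    Δ-at-source = begin
      deg * F va vb - neighbourSum F va vb  ≡⟨ cong (λ x → deg * x - neighbourSum F va vb) at-source ⟩
      deg * 1ℚ - neighbourSum F va vb
        ≤⟨ +-monoʳ-≤ (deg * 1ℚ) (neg-antimono-≤ (neighbourSum-nonNeg potential-nonNeg va vb)) ⟩
      deg * 1ℚ - 0ℚ                         ≡⟨ solve 1 (λ d → d :* con 1ℚ :- con 0ℚ := d) refl deg ⟩
      deg                                   ∎

Supersolution-flip : ∀ {n G} → Supersolution n G → Supersolution n (flip G)
Supersolution-flip {n} {G} S = record
  { supported = λ a b a∨b → supported b a (Sum.swap a∨b)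
  ; deg≤Δ     = λ a b a<n b<n →
      subst (deg ≤_) (cong (λ s → deg * G b a - s) (sym (neighbourSum-flip G a b))) (deg≤Δ b a b<n a<n)
  }
  where open Supersolution S

-- The solution of neighbours P = 2P − deg with P(−1) = P(n) = 0 (see parabola-neighbours).
parabola : ℕ → ℕ → ℚ
parabola n a = ℕ→ℚ 2 * (1ℚ + ℕ→ℚ a) * (ℕ→ℚ n - ℕ→ℚ a)

parabola-at-end : ∀ n → parabola n n ≡ 0ℚ
parabola-at-end n = solve 1 (λ x → con (ℕ→ℚ 2) :* (con 1ℚ :+ x) :* (x :- x) := con 0ℚ) refl (ℕ→ℚ n)

parabola-nonNeg : ∀ {n a} → a ℕ.≤ n → 0ℚ ≤ parabola n a
parabola-nonNeg {n} {a} a≤n =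
  *-nonNeg (*-nonNeg (ℕ→ℚ-nonNeg 2) (subst (0ℚ ≤_) (ℕ→ℚ-suc a) (ℕ→ℚ-nonNeg (suc a))))
      (subst (_≤ ℕ→ℚ n - ℕ→ℚ a) (+-inverseʳ (ℕ→ℚ a)) (+-monoˡ-≤ (- ℕ→ℚ a) (ℕ→ℚ-mono-≤ a≤n)))

parabola-neighbours : ∀ n a → neighbours (parabola n) a ≡ ℕ→ℚ 2 * parabola n a - deg
parabola-neighbours n zero = solve 1
  (λ N → con (ℕ→ℚ 2) :* (con 1ℚ :+ con (ℕ→ℚ 1)) :* (N :- con (ℕ→ℚ 1)) :+ con 0ℚ
     := con (ℕ→ℚ 2) :* (con (ℕ→ℚ 2) :* (con 1ℚ :+ con (ℕ→ℚ 0)) :* (N :- con (ℕ→ℚ 0))) :- con deg)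
  refl (ℕ→ℚ n)
parabola-neighbours n (suc a) = begin
  P (ℕ→ℚ (suc (suc a))) + P (ℕ→ℚ a)
    ≡⟨ cong (λ y → P y + P x) (trans (ℕ→ℚ-suc (suc a)) (cong (1ℚ +_) (ℕ→ℚ-suc a))) ⟩
  P (1ℚ + (1ℚ + x)) + P x
    ≡⟨ solve 2 (λ N x → P′ N (con 1ℚ :+ (con 1ℚ :+ x)) :+ P′ N x := con (ℕ→ℚ 2) :* P′ N (con 1ℚ :+ x) :- con deg)
               refl (ℕ→ℚ n) x ⟩
  ℕ→ℚ 2 * P (1ℚ + x) - deg              ≡⟨ cong (λ y → ℕ→ℚ 2 * P y - deg) (ℕ→ℚ-suc a) ⟨
  ℕ→ℚ 2 * P (ℕ→ℚ (suc a)) - deg        ∎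
  where
  open ≡-Reasoning
  x : ℚ
  x = ℕ→ℚ a
  P : ℚ → ℚ
  P y = ℕ→ℚ 2 * (1ℚ + y) * (ℕ→ℚ n - y)
  P′ : Polynomial 2 → Polynomial 2 → Polynomial 2
  P′ N y = con (ℕ→ℚ 2) :* (con 1ℚ :+ y) :* (N :- y)

parabola-boundary : ∀ {n a} → a ≡ 0 ⊎ suc a ≡ n → parabola n a ≡ ℕ→ℚ 2 * ℕ→ℚ n
parabola-boundary {n} (inj₁ refl) = solve 1
  (λ N → con (ℕ→ℚ 2) :* (con 1ℚ :+ con (ℕ→ℚ 0)) :* (N :- con (ℕ→ℚ 0)) := con (ℕ→ℚ 2) :* N) refl (ℕ→ℚ n)
parabola-boundary {a = a} (inj₂ refl) = begin
  ℕ→ℚ 2 * (1ℚ + x) * (ℕ→ℚ (suc a) - x)  ≡⟨ cong (λ y → ℕ→ℚ 2 * (1ℚ + x) * (y - x)) (ℕ→ℚ-suc a) ⟩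
  ℕ→ℚ 2 * (1ℚ + x) * (1ℚ + x - x)
    ≡⟨ solve 1 (λ x → con (ℕ→ℚ 2) :* (con 1ℚ :+ x) :* (con 1ℚ :+ x :- x) := con (ℕ→ℚ 2) :* (con 1ℚ :+ x)) refl x ⟩
  ℕ→ℚ 2 * (1ℚ + x)                       ≡⟨ cong (ℕ→ℚ 2 *_) (ℕ→ℚ-suc a) ⟨
  ℕ→ℚ 2 * ℕ→ℚ (suc a)                    ∎
  where
  open ≡-Reasoning
  x : ℚ
  x = ℕ→ℚ a

ext-supported : ∀ {n} (π : Pot n) → Supported n (ext π)
ext-supported {n} π a b a∨b with a ℕ.<? n | b ℕ.<? n
... | yes a<n | yes b<n = ⊥-elim (Sum.[ ℕ.<⇒≱ a<n , ℕ.<⇒≱ b<n ] a∨b)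
... | yes _   | no  _   = refl
... | no  _   | yes _   = refl
... | no  _   | no  _   = refl

ext-toℕ : ∀ {n} (π : Pot n) (i j : Fin n) → ext π (toℕ i) (toℕ j) ≡ π i j
ext-toℕ {n} π i j with toℕ i ℕ.<? n | toℕ j ℕ.<? n
... | yes i<n | yes j<n = cong₂ π (fromℕ<-toℕ i i<n) (fromℕ<-toℕ j j<n)
... | yes _   | no  j≮n = ⊥-elim (j≮n (toℕ<n j))
... | no  i≮n | _       = ⊥-elim (i≮n (toℕ<n i))

parabolaRows : ℕ → ℕ → ℕ → ℚ
parabolaRows n = ext {n} (λ i _ → parabola n (toℕ i))

parabolaRows-column : ∀ {n a b} → a ℕ.≤ n → b < n → parabolaRows n a b ≡ parabola n a
parabolaRows-column {n} {a} {b} a≤n b<n with a ℕ.<? n | b ℕ.<? n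
... | yes a<n | yes _   = cong (parabola n) (toℕ-fromℕ< a<n)
... | yes _   | no  b≮n = ⊥-elim (b≮n b<n)
... | no  a≮n | _       = sym (trans (cong (parabola n) (ℕ.≤-antisym a≤n (ℕ.≮⇒≥ a≮n))) (parabola-at-end n))

parabolaRows-≤ : ∀ {n a} b → a < n → parabolaRows n a b ≤ parabola n a
parabolaRows-≤ {n} {a} b a<n with a ℕ.<? n | b ℕ.<? n
... | yes a<n | yes _ = ≤-reflexive (cong (parabola n) (toℕ-fromℕ< a<n))
... | yes _   | no  _ = parabola-nonNeg (ℕ.<⇒≤ a<n)
... | no  a≮n | _     = ⊥-elim (a≮n a<n)

parabolaRows-supersolution : ∀ n → Supersolution n (parabolaRows n)
parabolaRows-supersolution n = record { supported = ext-supported _ ; deg≤Δ = deg≤Δ }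
  where
  G : ℕ → ℕ → ℚ
  G = parabolaRows n

  column : ∀ a b → a < n → b < n → neighbours (λ x → G x b) a ≡ neighbours (parabola n) a
  column a b a<n b<n = cong₂ _+_ (parabolaRows-column a<n b<n) (below-column a a<n)
    where
    below-column : ∀ a → a < n → below (λ x → G x b) a ≡ below (parabola n) a
    below-column zero    _   = refl
    below-column (suc a) a<n = parabolaRows-column (ℕ.<⇒≤ (ℕ.<-trans (ℕ.n<1+n a) a<n)) b<n

  row : ∀ a b → a < n → neighbours (G a) b ≤ parabola n a + parabola n a
  row a b a<n = +-mono-≤ (parabolaRows-≤ (suc b) a<n) (below-row b)
    where
    below-row : ∀ b → below (G a) b ≤ parabola n a
    below-row zero    = parabola-nonNeg (ℕ.<⇒≤ a<n)
    below-row (suc b) = parabolaRows-≤ b a<n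

  deg≤Δ : ∀ a b → a < n → b < n → deg ≤ Δ G a b
  deg≤Δ a b a<n b<n = begin
    deg
      ≡⟨ solve 1 (λ p → con deg := con deg :* p :- ((con (ℕ→ℚ 2) :* p :- con deg) :+ (p :+ p))) refl p ⟩
    deg * p - ((ℕ→ℚ 2 * p - deg) + (p + p))
      ≤⟨ +-monoʳ-≤ (deg * p) (neg-antimono-≤ (+-monoʳ-≤ (ℕ→ℚ 2 * p - deg) (row a b a<n))) ⟩
    deg * p - ((ℕ→ℚ 2 * p - deg) + neighbours (G a) b)
      ≡⟨ cong₂ (λ y z → deg * y - (z + neighbours (G a) b)) (sym (parabolaRows-column (ℕ.<⇒≤ a<n) b<n))
                                                           (sym (trans (column a b a<n b<n) (parabola-neighbours n a))) ⟩
    Δ G a b                                     ∎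
    where
    open ≤-Reasoning
    p : ℚ
    p = parabola n a

parabolaRows-at-boundary : ∀ {n} (vi vj : Fin n) → toℕ vi ≡ 0 ⊎ suc (toℕ vi) ≡ n →
  parabolaRows n (toℕ vi) (toℕ vj) ≡ ℕ→ℚ 2 * ℕ→ℚ n
parabolaRows-at-boundary vi vj vi∈∂ =
  trans (parabolaRows-column (ℕ.<⇒≤ (toℕ<n vi)) (toℕ<n vj)) (parabola-boundary vi∈∂)

boundary-supersolution : ∀ {n} (vi vj : Fin n) → AdjSink n vi vj →
  ∃[ G ] (Supersolution n G × G (toℕ vi) (toℕ vj) ≡ ℕ→ℚ 2 * ℕ→ℚ n)
boundary-supersolution {n} vi vj (inj₁ vi≡0) =
  parabolaRows n , parabolaRows-supersolution n , parabolaRows-at-boundary vi vj (inj₁ vi≡0)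
boundary-supersolution {n} vi vj (inj₂ (inj₁ vi≡n-1)) =
  parabolaRows n , parabolaRows-supersolution n , parabolaRows-at-boundary vi vj (inj₂ vi≡n-1)
boundary-supersolution {n} vi vj (inj₂ (inj₂ (inj₁ vj≡0))) =
  flip (parabolaRows n) , Supersolution-flip (parabolaRows-supersolution n) , parabolaRows-at-boundary vj vi (inj₁ vj≡0)
boundary-supersolution {n} vi vj (inj₂ (inj₂ (inj₂ vj≡n-1))) =
  flip (parabolaRows n) , Supersolution-flip (parabolaRows-supersolution n) , parabolaRows-at-boundary vj vi (inj₂ vj≡n-1)

ext-gridPotential : ∀ {n} {vi vj : Fin n} {π : Pot n} → IsPotential vi vj π →
  GridPotential n (toℕ vi) (toℕ vj) (ext π)
ext-gridPotential {n} {vi} {vj} {π} (π[v]≡1 , π-harmonic) = record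
  { va<n      = toℕ<n vi
  ; vb<n      = toℕ<n vj
  ; supported = ext-supported π
  ; at-source = trans (ext-toℕ π vi vj) π[v]≡1
  ; harmonic  = harmonic
  }
  where
  harmonicᶠ : ∀ i j → (i , j) ≢ (vi , vj) → deg * ext π (toℕ i) (toℕ j) ≡ neighbourSum (ext π) (toℕ i) (toℕ j)
  harmonicᶠ i j ij≢v = begin
    deg * ext π (toℕ i) (toℕ j)              ≡⟨ cong (deg *_) (ext-toℕ π i j) ⟩
    deg * π i j                              ≡⟨ π-harmonic i j ij≢v ⟩
    nbrSum π i j                             ≡⟨ +-assoc (neighbours (λ x → ext π x (toℕ j)) (toℕ i)) _ _ ⟩
    neighbourSum (ext π) (toℕ i) (toℕ j)     ∎
    where open ≡-Reasoning

  harmonic : ∀ a b → a < n → b < n → (a , b) ≢ (toℕ vi , toℕ vj) → deg * ext π a b ≡ neighbourSum (ext π) a b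
  harmonic a b a<n b<n ab≢v =
    subst₂ (λ a b → deg * ext π a b ≡ neighbourSum (ext π) a b) a≡ b≡ (harmonicᶠ _ _ ij≢v)
    where
    a≡ : toℕ (fromℕ< a<n) ≡ a
    a≡ = toℕ-fromℕ< a<n
    b≡ : toℕ (fromℕ< b<n) ≡ b
    b≡ = toℕ-fromℕ< b<n
    ij≢v : (fromℕ< a<n , fromℕ< b<n) ≢ (vi , vj)
    ij≢v ij≡v = ab≢v (subst₂ (λ x y → (x , y) ≡ (toℕ vi , toℕ vj)) a≡ b≡ (cong (Product.map toℕ toℕ) ij≡v))

sumFin≡∑ : ∀ n (f : Fin n → ℚ) (g : ℕ → ℚ) → (∀ i → f i ≡ g (toℕ i)) → sumFin n f ≡ ∑ n g
sumFin≡∑ zero    f g f≡g = refl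
sumFin≡∑ (suc n) f g f≡g = cong₂ _+_ (f≡g Fin.zero) (begin
  foldr _+_ 0ℚ (map f (tabulate Fin.suc))   ≡⟨ cong (foldr _+_ 0ℚ) (map-tabulate Fin.suc f) ⟩
  foldr _+_ 0ℚ (tabulate (f ∘ Fin.suc))     ≡⟨ cong (foldr _+_ 0ℚ) (map-tabulate id (f ∘ Fin.suc)) ⟨
  sumFin n (f ∘ Fin.suc)                    ≡⟨ sumFin≡∑ n (f ∘ Fin.suc) (g ∘ suc) (f≡g ∘ Fin.suc) ⟩
  ∑ n (g ∘ suc)                             ∎)
  where open ≡-Reasoning

sumV≡∑² : ∀ {n} (π : Pot n) (H : ℕ → ℕ → ℚ) → (∀ i j → π i j ≡ H (toℕ i) (toℕ j)) → sumV π ≡ ∑² n H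
sumV≡∑² {n} π H π≡H = sumFin≡∑ n _ _ (λ i → sumFin≡∑ n (π i) (H (toℕ i)) (π≡H i))

potential-mass≤ : ∀ {n} {vi vj : Fin n} {π : Pot n} → AdjSink n vi vj → IsPotential vi vj π →
  sumV π ≤ ℕ→ℚ 2 * ℕ→ℚ n
potential-mass≤ {n} {vi} {vj} {π} adj pot with boundary-supersolution vi vj adj
... | G , G-super , G[v]≡2n = begin
  sumV π               ≡⟨ sumV≡∑² π (ext π) (λ i j → sym (ext-toℕ π i j)) ⟩
  ∑² n (ext π)         ≤⟨ ∑²≤supersolution (ext-gridPotential pot) G-super 0≤G[v] ⟩
  G (toℕ vi) (toℕ vj)  ≡⟨ G[v]≡2n ⟩
  ℕ→ℚ 2 * ℕ→ℚ n       ∎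
  where
  open ≤-Reasoning
  0≤G[v] : 0ℚ ≤ G (toℕ vi) (toℕ vj)
  0≤G[v] = subst (0ℚ ≤_) (sym G[v]≡2n) (*-nonNeg (ℕ→ℚ-nonNeg 2) (ℕ→ℚ-nonNeg n))

Gamma≡3*sumV : ∀ {n} (π : Pot n) → Gamma π ≡ ℕ→ℚ 3 * sumV π
-- The first step uses that deg - 1ℚ and ℕ→ℚ 3 are the same closed rational.
Gamma≡3*sumV {n} π = begin
  Gamma π                           ≡⟨ sumV≡∑² _ _ (λ i j → cong (ℕ→ℚ 3 *_) (sym (ext-toℕ π i j))) ⟩
  ∑² n (λ a b → ℕ→ℚ 3 * ext π a b)  ≡⟨ *-distribˡ-∑² n (ℕ→ℚ 3) (ext π) ⟨
  ℕ→ℚ 3 * ∑² n (ext π)              ≡⟨ cong (ℕ→ℚ 3 *_) (sumV≡∑² π (ext π) (λ i j → sym (ext-toℕ π i j))) ⟨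
  ℕ→ℚ 3 * sumV π                    ∎
  where open ≡-Reasoning

lemma21 : ∃[ C ] ((n : ℕ) (vi vj : Fin n) → AdjSink n vi vj →
            (π : Pot n) → IsPotential vi vj π →
            (Gamma π ≡ ℕ→ℚ 3 * sumV π) × (Gamma π ≤ ℕ→ℚ C * ℕ→ℚ n))
lemma21 = 6 , λ n vi vj adj π pot → Gamma≡3*sumV π , (begin
  Gamma π                    ≡⟨ Gamma≡3*sumV π ⟩
  ℕ→ℚ 3 * sumV π             ≤⟨ *-monoˡ-≤-nonNeg (ℕ→ℚ 3) (potential-mass≤ adj pot) ⟩
  ℕ→ℚ 3 * (ℕ→ℚ 2 * ℕ→ℚ n)
    ≡⟨ solve 1 (λ N → con (ℕ→ℚ 3) :* (con (ℕ→ℚ 2) :* N) := con (ℕ→ℚ 6) :* N) refl (ℕ→ℚ n) ⟩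
  ℕ→ℚ 6 * ℕ→ℚ n              ∎)
  where open ≤-Reasoning
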